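{- Let $A,B$ be columns such that the two-column tableau $AB$ is a Young tableau, and let $AB\to A'B'$ denote the jeu de taquin transformation described in the context. (0) If $b\in A\cap B$, then $b\in A'\cap B'$. Suppose moreover $B\setminus A\neq\emptyset$. Let $\tilde b=\max(B\setminus A)$ and $\tilde a=\max\{a\in A\setminus B:\ a\le\tilde b\}$. Then: (1) $\tilde a\in A'$; (2) let $\tilde B=(B\setminus\{\tilde b\})\cup\{\tilde a\}$, and let $A\tilde B\to\tilde A'\tilde B'$ be the analogous transformation for the tableau $A\tilde B$; then $\tilde A'=A'$.
   Context: Columns and two-column tableaux. A column is a finite subset of $\{1,\dots,n\}$, identified with its strictly decreasing word. A two-column tableau $AB$ is a Young tableau if $|A|\ge|B|$ and, for each $r\le|B|$, the $r$-th smallest element of $A$ is at most the $r$-th smallest element of $B$. Its word is the decreasing word of $A$ followed by that of $B$. Plactic congruence. $\equiv$ is the Knuth congruence on words, generated by $xzy\equiv zxy$ for $x\le y<z$ and by $yxz\equiv yzx$ for $x<y\le z$. The transformation $AB\to A'B'$. For a two-column Young tableau $AB$ there is a unique pair of columns $A',B'$ with $|A'|=|B|$, $|B'|=|A|$ and $A'B'\equiv AB$ as words. This pair is obtained by applying the jeu de taquin to $AB$, and we write $AB\to A'B'$. -}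

module Defs where

open import Data.Nat using (ℕ; _≤_; _<_; _>_)
open import Data.List using (List; []; _∷_; _++_; reverse; length)
open import Data.List.Relation.Unary.All using (All)
open import Data.List.Relation.Unary.Linked using (Linked)
open import Data.Product using (_×_)
open import Relation.Binary.PropositionalEquality using (_≡_)
open import Relation.Binary.Construct.Closure.Equivalence using (EqClosure)

-- A column (a finite subset of {1,…,n}) is identified with its strictly
-- decreasing word, whose entries lie in {1,…,n}.
Column : ℕ → List ℕ → Set
Column n w = Linked _>_ w × All (λ x → 1 ≤ x × x ≤ n) w

-- Row condition on the increasing (reversed) words:
-- |A| ≥ |B| and the r-th smallest of A is ≤ the r-th smallest of B.
data RowsOK : List ℕ → List ℕ → Set where
  rows-[] : ∀ {xs} → RowsOK xs []
  rows-∷  : ∀ {x y xs ys} → x ≤ y → RowsOK xs ys → RowsOK (x ∷ xs) (y ∷ ys)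

YoungTableau : List ℕ → List ℕ → Set
YoungTableau A B = RowsOK (reverse A) (reverse B)

data KnuthStep : List ℕ → List ℕ → Set where
  knuth₁ : ∀ {x y z} (u v : List ℕ) → x ≤ y → y < z →
           KnuthStep (u ++ x ∷ z ∷ y ∷ v) (u ++ z ∷ x ∷ y ∷ v)
  knuth₂ : ∀ {x y z} (u v : List ℕ) → x < y → y ≤ z →
           KnuthStep (u ++ y ∷ x ∷ z ∷ v) (u ++ y ∷ z ∷ x ∷ v)

_≡ₚ_ : List ℕ → List ℕ → Set
_≡ₚ_ = EqClosure KnuthStep

JdT : ℕ → List ℕ → List ℕ → List ℕ → List ℕ → Set
JdT n A B A' B' =
  Column n A' × Column n B' × length A' ≡ length B × length B' ≡ length A ×
  (A' ++ B') ≡ₚ (A ++ B)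

-- Two statistics of a word are invariant under the plactic congruence: the number
-- countBelow c w of its letters below c, and the length lds c w of a longest strictly
-- decreasing subsequence of its letters below c.  For a two-column tableau A B one has
-- lds c (A B) = countBelow c A, so A' B' ≡ A B gives, for every c, an equation between
-- A', B' and A.  Read letter by letter, these equations show that A' ⊆ A, that letters
-- outside A ∖ B occur in A' and B' exactly as in A and B, and that a letter v of A ∖ B
-- moves to B' only when B' and A have equally many letters below v.  The letters of A
-- between ã and b̃ all lie in B, and counting them shows that ã cannot move.  For (2),
-- the same equations for both transformations force A' and Ã' to agree letter by letter.

module Submission where

open import Defs
open import Data.Nat using (ℕ; zero; suc; _≤_; _<_; _>_; _+_; _⊔_; z≤n; s≤s; _≟_; _<?_; _≤′_; ≤′-refl; ≤′-step)
open import Data.Nat.Properties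
open import Data.List using (List; []; _∷_; _++_; length; reverse; filter)
open import Data.List.Properties using (length-++; filter-++; filter-accept; filter-reject; filter-all; filter-none; filter-some)
open import Data.List.Membership.Propositional using (_∈_; _∉_)
open import Data.List.Membership.DecPropositional _≟_ using (_∈?_)
open import Data.List.Relation.Unary.Any using (here; there)
open import Data.List.Relation.Unary.All as All using (All; []; _∷_)
open import Data.List.Relation.Unary.All.Properties using (¬Any⇒All¬)
open import Data.List.Relation.Unary.Linked as Linked using (Linked; []; [-]; _∷_)
open import Data.List.Relation.Unary.Linked.Properties using (Linked⇒All)
open import Data.List.Relation.Binary.Permutation.Propositional using (_↭_; prep; swap; ↭-isEquivalence)
open import Data.List.Relation.Binary.Permutation.Propositional.Properties using (↭-length; ↭-reverse; ++⁺ˡ; filter-↭)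
open import Data.Product using (_×_; _,_; proj₁; proj₂; Σ-syntax)
open import Data.Sum using (_⊎_; inj₁; inj₂; map₂)
open import Data.Empty using (⊥-elim)
open import Function using (_∘_; flip)
open import Function.Bundles using (_⇔_; Equivalence)
open import Relation.Nullary using (yes; no; ¬_; contradiction)
open import Relation.Nullary.Decidable using (toSum)
open import Relation.Binary.Definitions using (tri<; tri≈; tri>)
open import Relation.Binary.PropositionalEquality
open import Relation.Binary.Bundles using (Setoid)
open import Relation.Binary.Construct.Closure.Equivalence using (fold; gfold)
open import Algebra.Bundles using (IdempotentCommutativeMonoid)
open import Algebra.Properties.CommutativeSemigroup +-commutativeSemigroup using (x∙yz≈y∙xz)
import Algebra.Solver.IdempotentCommutativeMonoid as ICM-Solver
open import Data.Fin using (zero; suc)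
open import Data.Vec using ([]; _∷_)

bits-+≡2 : ∀ {m n} → m ≤ 1 → n ≤ 1 → m + n ≡ 2 → m ≡ 1 × n ≡ 1
bits-+≡2 (s≤s z≤n) (s≤s z≤n) _ = refl , refl
bits-+≡2 (s≤s z≤n) z≤n ()
bits-+≡2 z≤n (s≤s z≤n) ()
bits-+≡2 z≤n z≤n ()

bits-+≡1 : ∀ {m n} → m ≤ 1 → n ≤ 1 → m + n ≡ 1 → (m ≡ 1 × n ≡ 0) ⊎ (m ≡ 0 × n ≡ 1)
bits-+≡1 (s≤s z≤n) z≤n _ = inj₁ (refl , refl)
bits-+≡1 z≤n (s≤s z≤n) _ = inj₂ (refl , refl)
bits-+≡1 (s≤s z≤n) (s≤s z≤n) ()
bits-+≡1 z≤n z≤n ()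

suc≡⊔suc⇒≡ : ∀ {m n} → suc m ≡ m ⊔ suc n → m ≡ n
suc≡⊔suc⇒≡ {m} {n} eq with ≤-total m (suc n)
... | inj₁ m≤1+n = suc-injective (trans eq (m≤n⇒m⊔n≡n m≤1+n))
... | inj₂ 1+n≤m = contradiction (trans eq (m≥n⇒m⊔n≡m 1+n≤m)) 1+n≢n

m+n≤o+p∧p<m⇒n<o : ∀ {m n o p} → m + n ≤ o + p → p < m → n < o
m+n≤o+p∧p<m⇒n<o {m} {n} {o} {p} le p<m =
  +-cancelˡ-< m n o (≤-<-trans le (subst (o + p <_) (+-comm o m) (+-monoʳ-< o p<m)))

countBelow : ℕ → List ℕ → ℕ
countBelow b w = length (filter (_<? b) w)

count : ℕ → List ℕ → ℕ
count v w = length (filter (v ≟_) w)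

countBelow-accept : ∀ {b x} w → x < b → countBelow b (x ∷ w) ≡ suc (countBelow b w)
countBelow-accept {b} w x<b = cong length (filter-accept (_<? b) {xs = w} x<b)

countBelow-reject : ∀ {b x} w → ¬ x < b → countBelow b (x ∷ w) ≡ countBelow b w
countBelow-reject {b} w x≮b = cong length (filter-reject (_<? b) {xs = w} x≮b)

count-accept : ∀ {v x} w → v ≡ x → count v (x ∷ w) ≡ suc (count v w)
count-accept {v} w v≡x = cong length (filter-accept (v ≟_) {xs = w} v≡x)

count-reject : ∀ {v x} w → v ≢ x → count v (x ∷ w) ≡ count v w
count-reject {v} w v≢x = cong length (filter-reject (v ≟_) {xs = w} v≢x)

∉⇒count≡0 : ∀ {v w} → v ∉ w → count v w ≡ 0
∉⇒count≡0 {v} {w} v∉w = cong length (filter-none (v ≟_) (¬Any⇒All¬ w v∉w))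

∈⇒count≢0 : ∀ {v w} → v ∈ w → count v w ≢ 0
∈⇒count≢0 {v} v∈w = <⇒≢ (filter-some (v ≟_) v∈w) ∘ sym

count≢0⇒∈ : ∀ {v w} → count v w ≢ 0 → v ∈ w
count≢0⇒∈ {v} {w} c≢0 with v ∈? w
... | yes v∈w = v∈w
... | no v∉w = contradiction (∉⇒count≡0 v∉w) c≢0

count≡0⇒∉ : ∀ {v w} → count v w ≡ 0 → v ∉ w
count≡0⇒∉ c≡0 v∈w = ∈⇒count≢0 v∈w c≡0

count≡1⇒∈ : ∀ {v w} → count v w ≡ 1 → v ∈ w
count≡1⇒∈ c≡1 = count≢0⇒∈ (1+n≢0 ∘ trans (sym c≡1))

count≡⇒∈ : ∀ {v X Y} → count v X ≡ count v Y → v ∈ Y → v ∈ X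
count≡⇒∈ {v} {X} {Y} eq v∈Y = count≢0⇒∈ (∈⇒count≢0 v∈Y ∘ trans (sym eq))

countBelow-++ : ∀ b u w → countBelow b (u ++ w) ≡ countBelow b u + countBelow b w
countBelow-++ b u w = trans (cong length (filter-++ (_<? b) u w)) (length-++ (filter (_<? b) u))

count-++ : ∀ v u w → count v (u ++ w) ≡ count v u + count v w
count-++ v u w = trans (cong length (filter-++ (v ≟_) u w)) (length-++ (filter (v ≟_) u))

countBelow-zero : ∀ w → countBelow 0 w ≡ 0
countBelow-zero w = cong length (filter-none (_<? 0) (All.universal (λ _ ()) w))

countBelow-all : ∀ {b w} → All (_< b) w → countBelow b w ≡ length w
countBelow-all {b} all = cong length (filter-all (_<? b) all)

countBelow-suc : ∀ c w → countBelow (suc c) w ≡ count c w + countBelow c w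
countBelow-suc c [] = refl
countBelow-suc c (x ∷ w) with <-cmp x c
... | tri< x<c x≢c _ = begin
  countBelow (suc c) (x ∷ w)         ≡⟨ countBelow-accept w (m<n⇒m<1+n x<c) ⟩
  suc (countBelow (suc c) w)         ≡⟨ cong suc (countBelow-suc c w) ⟩
  suc (count c w + countBelow c w)   ≡⟨ +-suc (count c w) _ ⟨
  count c w + suc (countBelow c w)   ≡⟨ cong₂ _+_ (count-reject w (x≢c ∘ sym)) (countBelow-accept w x<c) ⟨
  count c (x ∷ w) + countBelow c (x ∷ w) ∎
  where open ≡-Reasoning
... | tri≈ _ refl _ = begin
  countBelow (suc x) (x ∷ w)         ≡⟨ countBelow-accept w ≤-refl ⟩
  suc (countBelow (suc x) w)         ≡⟨ cong suc (countBelow-suc x w) ⟩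
  suc (count x w + countBelow x w)   ≡⟨ cong₂ _+_ (count-accept w refl) (countBelow-reject w (n≮n x)) ⟨
  count x (x ∷ w) + countBelow x (x ∷ w) ∎
  where open ≡-Reasoning
... | tri> _ x≢c c<x = begin
  countBelow (suc c) (x ∷ w)         ≡⟨ countBelow-reject w (<⇒≱ c<x ∘ ≤-pred) ⟩
  countBelow (suc c) w               ≡⟨ countBelow-suc c w ⟩
  count c w + countBelow c w         ≡⟨ cong₂ _+_ (count-reject w (x≢c ∘ sym)) (countBelow-reject w (<-asym c<x)) ⟨
  count c (x ∷ w) + countBelow c (x ∷ w) ∎
  where open ≡-Reasoning

countBelow-suc-count : ∀ {k c} X → count k X ≡ c → countBelow (suc k) X ≡ c + countBelow k X
countBelow-suc-count {k} X eq = trans (countBelow-suc k X) (cong (_+ countBelow k X) eq)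

countBelow-suc-∉ : ∀ {v w} → v ∉ w → countBelow (suc v) w ≡ countBelow v w
countBelow-suc-∉ {v} {w} v∉w = trans (countBelow-suc v w) (cong (_+ countBelow v w) (∉⇒count≡0 v∉w))

countBelow-≤-suc : ∀ c w → countBelow c w ≤ countBelow (suc c) w
countBelow-≤-suc c w = subst (countBelow c w ≤_) (sym (countBelow-suc c w)) (m≤n+m _ _)

countBelow-cons-≤ : ∀ b x w → countBelow b w ≤ countBelow b (x ∷ w)
countBelow-cons-≤ b x w = subst (countBelow b w ≤_) (sym (countBelow-++ b (x ∷ []) w)) (m≤n+m _ _)

countBelow-from-count : ∀ {X Y} → (∀ v → count v X ≡ count v Y) → ∀ c → countBelow c X ≡ countBelow c Y
countBelow-from-count {X} {Y} _ zero = trans (countBelow-zero X) (sym (countBelow-zero Y))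
countBelow-from-count {X} {Y} same (suc c) = begin
  countBelow (suc c) X       ≡⟨ countBelow-suc c X ⟩
  count c X + countBelow c X ≡⟨ cong₂ _+_ (same c) (countBelow-from-count {X} {Y} same c) ⟩
  count c Y + countBelow c Y ≡⟨ countBelow-suc c Y ⟨
  countBelow (suc c) Y ∎
  where open ≡-Reasoning

countBelow-interval : ∀ {X Y lo hi} → lo ≤ hi → (∀ w → lo ≤ w → w < hi → count w X ≤ count w Y) →
                      countBelow hi X + countBelow lo Y ≤ countBelow lo X + countBelow hi Y
countBelow-interval {X} {Y} lo≤hi = go (≤⇒≤′ lo≤hi)
  where
  go : ∀ {lo hi} → lo ≤′ hi → (∀ w → lo ≤ w → w < hi → count w X ≤ count w Y) →
       countBelow hi X + countBelow lo Y ≤ countBelow lo X + countBelow hi Y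
  go ≤′-refl _ = ≤-refl
  go {lo} (≤′-step {h} lo≤′h) X≤Y = begin
    countBelow (suc h) X + countBelow lo Y       ≡⟨ cong (_+ countBelow lo Y) (countBelow-suc h X) ⟩
    (count h X + countBelow h X) + countBelow lo Y ≡⟨ +-assoc (count h X) (countBelow h X) (countBelow lo Y) ⟩
    count h X + (countBelow h X + countBelow lo Y) ≤⟨ +-mono-≤ (X≤Y h (≤′⇒≤ lo≤′h) ≤-refl)
                                                       (go lo≤′h (λ w lo≤w w<h → X≤Y w lo≤w (m<n⇒m<1+n w<h))) ⟩
    count h Y + (countBelow lo X + countBelow h Y) ≡⟨ x∙yz≈y∙xz (count h Y) (countBelow lo X) (countBelow h Y) ⟩
    countBelow lo X + (count h Y + countBelow h Y) ≡⟨ cong (countBelow lo X +_) (countBelow-suc h Y) ⟨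
    countBelow lo X + countBelow (suc h) Y ∎
    where open ≤-Reasoning

plactic⇒↭ : ∀ {w w'} → w ≡ₚ w' → w ↭ w'
plactic⇒↭ = fold ↭-isEquivalence knuthStep⇒↭
  where
  knuthStep⇒↭ : ∀ {w w'} → KnuthStep w w' → w ↭ w'
  knuthStep⇒↭ (knuth₁ {x} {_} {z} u v _ _) = ++⁺ˡ u (swap x z _↭_.refl)
  knuthStep⇒↭ (knuth₂ {x} {y} {z} u v _ _) = ++⁺ˡ u (prep y (swap x z _↭_.refl))

count-↭ : ∀ v {w w'} → w ↭ w' → count v w ≡ count v w'
count-↭ v = ↭-length ∘ filter-↭ (v ≟_)

countBelow-↭ : ∀ b {w w'} → w ↭ w' → countBelow b w ≡ countBelow b w'
countBelow-↭ b = ↭-length ∘ filter-↭ (_<? b)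

-- lds b w is the length of a longest strictly decreasing subsequence of w
-- all of whose letters are < b.
lds : ℕ → List ℕ → ℕ
lds b [] = 0
lds b (x ∷ w) with x <? b
... | yes _ = suc (lds x w) ⊔ lds b w
... | no _ = lds b w

lds-accept : ∀ {b x} w → x < b → lds b (x ∷ w) ≡ suc (lds x w) ⊔ lds b w
lds-accept {b} {x} w x<b with x <? b
... | yes _ = refl
... | no x≮b = contradiction x<b x≮b

lds-reject : ∀ {b x} w → ¬ x < b → lds b (x ∷ w) ≡ lds b w
lds-reject {b} {x} w x≮b with x <? b
... | yes x<b = contradiction x<b x≮b
... | no _ = refl

lds-zero : ∀ w → lds 0 w ≡ 0
lds-zero [] = refl
lds-zero (x ∷ w) = trans (lds-reject {0} {x} w λ ()) (lds-zero w)

lds-mono : ∀ {b b'} w → b ≤ b' → lds b w ≤ lds b' w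
lds-mono [] _ = z≤n
lds-mono {b} {b'} (x ∷ w) b≤b' with x <? b | x <? b'
... | yes _ | yes _ = ⊔-monoʳ-≤ (suc (lds x w)) (lds-mono w b≤b')
... | yes x<b | no x≮b' = contradiction (<-≤-trans x<b b≤b') x≮b'
... | no _ | yes _ = ≤-trans (lds-mono w b≤b') (m≤n⊔m _ _)
... | no _ | no _ = lds-mono w b≤b'

lds-suc-≤ : ∀ b w → lds (suc b) w ≤ suc (lds b w)
lds-suc-≤ b [] = z≤n
lds-suc-≤ b (x ∷ w) with <-cmp x b
... | tri< x<b _ _ = subst₂ _≤_ (sym (lds-accept w (m<n⇒m<1+n x<b))) (cong suc (sym (lds-accept w x<b)))
        (⊔-lub (≤-trans (m≤m⊔n (suc (lds x w)) (lds b w)) (n≤1+n _))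
               (≤-trans (lds-suc-≤ b w) (s≤s (m≤n⊔m (suc (lds x w)) (lds b w)))))
... | tri≈ _ refl _ = subst₂ _≤_ (sym (lds-accept w ≤-refl)) (cong suc (sym (lds-reject w (n≮n x))))
        (⊔-lub ≤-refl (lds-suc-≤ x w))
... | tri> _ _ b<x = subst₂ _≤_ (sym (lds-reject w (<⇒≱ b<x ∘ ≤-pred)))
        (cong suc (sym (lds-reject w (<-asym b<x)))) (lds-suc-≤ b w)

lds-cons′ : ∀ y c {w w'} → lds y w ≡ lds y w' → lds c w ≡ lds c w' → lds c (y ∷ w) ≡ lds c (y ∷ w')
lds-cons′ y c y-eq c-eq with y <? c
... | yes _ = cong₂ (λ p q → suc p ⊔ q) y-eq c-eq
... | no _ = c-eq

lds-cons : ∀ y {w w'} → (∀ c → lds c w ≡ lds c w') → ∀ c → lds c (y ∷ w) ≡ lds c (y ∷ w')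
lds-cons y w≈w' c = lds-cons′ y c (w≈w' y) (w≈w' c)

lds-++ˡ : ∀ u {w w'} → (∀ c → lds c w ≡ lds c w') → ∀ c → lds c (u ++ w) ≡ lds c (u ++ w')
lds-++ˡ [] w≈w' = w≈w'
lds-++ˡ (y ∷ u) w≈w' = lds-cons y (lds-++ˡ u w≈w')

lds-swap : ∀ {x z} c w → x < z → c ≤ z → lds c (x ∷ z ∷ w) ≡ lds c (z ∷ x ∷ w)
lds-swap {x} {z} c w x<z c≤z with <-≤-connex x c
... | inj₁ x<c = begin
    lds c (x ∷ z ∷ w)                 ≡⟨ lds-accept (z ∷ w) x<c ⟩
    suc (lds x (z ∷ w)) ⊔ lds c (z ∷ w) ≡⟨ cong₂ (λ p q → suc p ⊔ q) (lds-reject w (<-asym x<z)) (lds-reject w (≤⇒≯ c≤z)) ⟩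
    suc (lds x w) ⊔ lds c w           ≡⟨ lds-accept w x<c ⟨
    lds c (x ∷ w)                     ≡⟨ lds-reject (x ∷ w) (≤⇒≯ c≤z) ⟨
    lds c (z ∷ x ∷ w) ∎
  where open ≡-Reasoning
... | inj₂ c≤x = begin
    lds c (x ∷ z ∷ w) ≡⟨ lds-reject (z ∷ w) (≤⇒≯ c≤x) ⟩
    lds c (z ∷ w)     ≡⟨ lds-reject w (≤⇒≯ c≤z) ⟩
    lds c w           ≡⟨ lds-reject w (≤⇒≯ c≤x) ⟨
    lds c (x ∷ w)     ≡⟨ lds-reject (x ∷ w) (≤⇒≯ c≤z) ⟨
    lds c (z ∷ x ∷ w) ∎
  where open ≡-Reasoning

⊔-icm : IdempotentCommutativeMonoid _ _
⊔-icm = record { isIdempotentCommutativeMonoid = record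
  { isCommutativeMonoid = ⊔-0-isCommutativeMonoid ; idem = ⊔-idem } }

open ICM-Solver ⊔-icm using (prove; var; _⊕_)

lds-knuth₁ : ∀ {x y z} v → x ≤ y → y < z → ∀ c → lds c (x ∷ z ∷ y ∷ v) ≡ lds c (z ∷ x ∷ y ∷ v)
lds-knuth₁ {x} {y} {z} v x≤y y<z c with <-≤-connex z c
... | inj₂ c≤z = lds-swap c (y ∷ v) (≤-<-trans x≤y y<z) c≤z
... | inj₁ z<c = begin
    lds c (x ∷ z ∷ y ∷ v)
      ≡⟨ lds-accept (z ∷ y ∷ v) x<c ⟩
    suc (lds x (z ∷ y ∷ v)) ⊔ lds c (z ∷ y ∷ v)
      ≡⟨ cong₂ (λ p q → suc p ⊔ q) (trans (lds-reject (y ∷ v) (<-asym x<z)) (lds-reject v (≤⇒≯ x≤y))) (lds-accept (y ∷ v) z<c) ⟩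
    suc a ⊔ (suc (lds z (y ∷ v)) ⊔ lds c (y ∷ v))
      ≡⟨ cong₂ (λ p q → suc a ⊔ (suc p ⊔ q)) (lds-accept v y<z) (lds-accept v y<c) ⟩
    suc a ⊔ (suc (suc b ⊔ d) ⊔ (suc b ⊔ e))
      ≡⟨ m≥n⇒m⊔n≡m ssa≤ ⟨
    (suc a ⊔ (suc (suc b ⊔ d) ⊔ (suc b ⊔ e))) ⊔ suc (suc a)
      ≡⟨ regroup ⟩
    suc (suc a ⊔ (suc b ⊔ d)) ⊔ (suc a ⊔ (suc b ⊔ e))
      ≡⟨ cong₂ (λ p q → suc (suc a ⊔ p) ⊔ (suc a ⊔ q)) (lds-accept v y<z) (lds-accept v y<c) ⟨
    suc (suc a ⊔ lds z (y ∷ v)) ⊔ (suc a ⊔ lds c (y ∷ v))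
      ≡⟨ cong (λ p → suc (suc p ⊔ lds z (y ∷ v)) ⊔ (suc p ⊔ lds c (y ∷ v))) (lds-reject v (≤⇒≯ x≤y)) ⟨
    suc (suc (lds x (y ∷ v)) ⊔ lds z (y ∷ v)) ⊔ (suc (lds x (y ∷ v)) ⊔ lds c (y ∷ v))
      ≡⟨ cong₂ (λ p q → suc p ⊔ q) (lds-accept (y ∷ v) x<z) (lds-accept (y ∷ v) x<c) ⟨
    suc (lds z (x ∷ y ∷ v)) ⊔ lds c (x ∷ y ∷ v)
      ≡⟨ lds-accept (x ∷ y ∷ v) z<c ⟨
    lds c (z ∷ x ∷ y ∷ v) ∎
  where
  open ≡-Reasoning
  x<z = ≤-<-trans x≤y y<z
  y<c = <-trans y<z z<c
  x<c = ≤-<-trans x≤y y<c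
  a = lds x v
  b = lds y v
  d = lds z v
  e = lds c v
  -- the new term suc (suc a) is absorbed because a ≤ b
  ssa≤ : suc (suc a) ≤ suc a ⊔ (suc (suc b ⊔ d) ⊔ (suc b ⊔ e))
  ssa≤ = ≤-trans (s≤s (s≤s (lds-mono v x≤y)))
           (≤-trans (≤-trans (m≤m⊔n (suc (suc b)) (suc d)) (m≤m⊔n _ (suc b ⊔ e))) (m≤n⊔m (suc a) _))
  regroup : (suc a ⊔ (suc (suc b ⊔ d) ⊔ (suc b ⊔ e))) ⊔ suc (suc a)
          ≡ suc (suc a ⊔ (suc b ⊔ d)) ⊔ (suc a ⊔ (suc b ⊔ e))
  regroup = prove 6 ((A ⊕ ((SSB ⊕ SD) ⊕ (SB ⊕ E))) ⊕ SSA) ((SSA ⊕ (SSB ⊕ SD)) ⊕ (A ⊕ (SB ⊕ E)))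
              (suc a ∷ suc (suc b) ∷ suc d ∷ suc b ∷ e ∷ suc (suc a) ∷ [])
    where
    A = var zero
    SSB = var (suc zero)
    SD = var (suc (suc zero))
    SB = var (suc (suc (suc zero)))
    E = var (suc (suc (suc (suc zero))))
    SSA = var (suc (suc (suc (suc (suc zero)))))

lds-knuth₂ : ∀ {x y z} v → x < y → y ≤ z → ∀ c → lds c (y ∷ x ∷ z ∷ v) ≡ lds c (y ∷ z ∷ x ∷ v)
lds-knuth₂ {x} {y} {z} v x<y y≤z c with <-≤-connex z c
... | inj₂ c≤z = lds-cons′ y c (lds-swap y v x<z y≤z) (lds-swap c v x<z c≤z)
  where x<z = <-≤-trans x<y y≤z
... | inj₁ z<c = begin
    lds c (y ∷ x ∷ z ∷ v)                     ≡⟨ lds-accept (x ∷ z ∷ v) y<c ⟩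
    suc (lds y (x ∷ z ∷ v)) ⊔ lds c (x ∷ z ∷ v) ≡⟨ cong₂ (λ p q → suc p ⊔ q) e₁ e₂ ⟩
    suc (suc a ⊔ b) ⊔ (suc a ⊔ (suc d ⊔ e))   ≡⟨ regroup ⟩
    suc (suc a ⊔ b) ⊔ (suc (suc a ⊔ d) ⊔ (suc a ⊔ e)) ≡⟨ cong₂ (λ p q → suc p ⊔ q) e₃ e₄ ⟨
    suc (lds y (z ∷ x ∷ v)) ⊔ lds c (z ∷ x ∷ v) ≡⟨ lds-accept (z ∷ x ∷ v) y<c ⟨
    lds c (y ∷ z ∷ x ∷ v) ∎
  where
  open ≡-Reasoning
  x<z = <-≤-trans x<y y≤z
  y<c = ≤-<-trans y≤z z<c
  x<c = <-trans x<y y<c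
  a = lds x v
  b = lds y v
  d = lds z v
  e = lds c v
  e₀ : lds x (z ∷ v) ≡ a
  e₀ = lds-reject v (<-asym x<z)
  e₁ : lds y (x ∷ z ∷ v) ≡ suc a ⊔ b
  e₁ = trans (lds-accept (z ∷ v) x<y) (cong₂ (λ p q → suc p ⊔ q) e₀ (lds-reject v (≤⇒≯ y≤z)))
  e₂ : lds c (x ∷ z ∷ v) ≡ suc a ⊔ (suc d ⊔ e)
  e₂ = trans (lds-accept (z ∷ v) x<c) (cong₂ (λ p q → suc p ⊔ q) e₀ (lds-accept v z<c))
  e₃ : lds y (z ∷ x ∷ v) ≡ suc a ⊔ b
  e₃ = trans (lds-reject (x ∷ v) (≤⇒≯ y≤z)) (lds-accept v x<y)
  e₄ : lds c (z ∷ x ∷ v) ≡ suc (suc a ⊔ d) ⊔ (suc a ⊔ e)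
  e₄ = trans (lds-accept (x ∷ v) z<c) (cong₂ (λ p q → suc p ⊔ q) (lds-accept v x<z) (lds-accept v x<c))
  regroup : suc (suc a ⊔ b) ⊔ (suc a ⊔ (suc d ⊔ e)) ≡ suc (suc a ⊔ b) ⊔ (suc (suc a ⊔ d) ⊔ (suc a ⊔ e))
  regroup = prove 5 ((SSA ⊕ SB) ⊕ (SA ⊕ (SD ⊕ E))) ((SSA ⊕ SB) ⊕ ((SSA ⊕ SD) ⊕ (SA ⊕ E)))
              (suc (suc a) ∷ suc b ∷ suc a ∷ suc d ∷ e ∷ [])
    where
    SSA = var zero
    SB = var (suc zero)
    SA = var (suc (suc zero))
    SD = var (suc (suc (suc zero)))
    E = var (suc (suc (suc (suc zero))))

lds-plactic : ∀ {w w'} → w ≡ₚ w' → ∀ c → lds c w ≡ lds c w'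
lds-plactic = gfold (Setoid.isEquivalence (ℕ →-setoid ℕ)) (λ w c → lds c w) knuthStep
  where
  knuthStep : ∀ {w w'} → KnuthStep w w' → ∀ c → lds c w ≡ lds c w'
  knuthStep (knuth₁ u v x≤y y<z) = lds-++ˡ u (lds-knuth₁ v x≤y y<z)
  knuthStep (knuth₂ u v x<y y≤z) = lds-++ˡ u (lds-knuth₂ v x<y y≤z)

Decreasing : List ℕ → Set
Decreasing = Linked _>_

decreasing-head : ∀ {x w} → Decreasing (x ∷ w) → All (_< x) w
decreasing-head [-] = []
decreasing-head (x>y ∷ d) = Linked⇒All (λ p q → <-trans q p) x>y d

All<⇒∉ : ∀ {x w} → All (_< x) w → x ∉ w
All<⇒∉ all x∈w = n≮n _ (All.lookup all x∈w)

decreasing-∉ : ∀ {x y w} → Decreasing (x ∷ w) → x < y → y ∉ x ∷ w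
decreasing-∉ d x<y = All<⇒∉ (x<y ∷ All.map (λ z<x → <-trans z<x x<y) (decreasing-head d))

count-decreasing-≤1 : ∀ {v w} → Decreasing w → count v w ≤ 1
count-decreasing-≤1 {v} {[]} _ = z≤n
count-decreasing-≤1 {v} {x ∷ w} d with toSum (v ≟ x)
... | inj₁ refl = ≤-reflexive (trans (count-accept w refl) (cong suc (∉⇒count≡0 (All<⇒∉ (decreasing-head d)))))
... | inj₂ v≢x = subst (_≤ 1) (sym (count-reject w v≢x)) (count-decreasing-≤1 (Linked.tail d))

count-decreasing-∈ : ∀ {v w} → Decreasing w → v ∈ w → count v w ≡ 1
count-decreasing-∈ {v} d v∈w = ≤-antisym (count-decreasing-≤1 d) (filter-some (v ≟_) v∈w)

count-decreasing-⇔ : ∀ {v X Y} → Decreasing X → Decreasing Y → (v ∈ X → v ∈ Y) → (v ∈ Y → v ∈ X) →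
                     count v X ≡ count v Y
count-decreasing-⇔ {v} {X} dX dY to from with v ∈? X
... | yes v∈X = trans (count-decreasing-∈ dX v∈X) (sym (count-decreasing-∈ dY (to v∈X)))
... | no v∉X = trans (∉⇒count≡0 v∉X) (sym (∉⇒count≡0 (v∉X ∘ from)))

countBelow-suc-∈ : ∀ {v w} → Decreasing w → v ∈ w → countBelow (suc v) w ≡ suc (countBelow v w)
countBelow-suc-∈ {v} {w} d v∈w = trans (countBelow-suc v w) (cong (_+ countBelow v w) (count-decreasing-∈ d v∈w))

lds-decreasing : ∀ b {w} → Decreasing w → lds b w ≡ countBelow b w
lds-decreasing b {[]} _ = refl
lds-decreasing b {x ∷ w} d with <-≤-connex x b
... | inj₂ b≤x = trans (lds-reject w (≤⇒≯ b≤x)) (trans (lds-decreasing b (Linked.tail d)) (sym (countBelow-reject w (≤⇒≯ b≤x))))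
... | inj₁ x<b = begin
   lds b (x ∷ w)                         ≡⟨ lds-accept w x<b ⟩
   suc (lds x w) ⊔ lds b w               ≡⟨ cong₂ (λ p q → suc p ⊔ q) (lds-decreasing x (Linked.tail d)) (lds-decreasing b (Linked.tail d)) ⟩
   suc (countBelow x w) ⊔ countBelow b w ≡⟨ cong₂ (λ p q → suc p ⊔ q) (countBelow-all w<x) (countBelow-all (All.map (λ y<x → <-trans y<x x<b) w<x)) ⟩
   suc (length w) ⊔ length w             ≡⟨ m≥n⇒m⊔n≡m (n≤1+n _) ⟩
   suc (length w)                        ≡⟨ cong suc (countBelow-all (All.map (λ y<x → <-trans y<x x<b) w<x)) ⟨
   suc (countBelow b w)                  ≡⟨ countBelow-accept w x<b ⟨
   countBelow b (x ∷ w) ∎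
  where
  open ≡-Reasoning
  w<x = decreasing-head d

decreasing-ext : ∀ {X Y} → Decreasing X → Decreasing Y → (∀ v → count v X ≡ count v Y) → X ≡ Y
decreasing-ext {[]} {[]} _ _ _ = refl
decreasing-ext {[]} {y ∷ Y} _ _ same = ⊥-elim (∈⇒count≢0 {y} {y ∷ Y} (here refl) (sym (same y)))
decreasing-ext {x ∷ X} {[]} _ _ same = ⊥-elim (∈⇒count≢0 {x} {x ∷ X} (here refl) (same x))
decreasing-ext {x ∷ X} {y ∷ Y} dX dY same with <-cmp x y
... | tri< x<y _ _ = ⊥-elim (decreasing-∉ dX x<y (count≢0⇒∈ (∈⇒count≢0 {y} {y ∷ Y} (here refl) ∘ trans (sym (same y)))))
... | tri> _ _ y<x = ⊥-elim (decreasing-∉ dY y<x (count≢0⇒∈ (∈⇒count≢0 {x} {x ∷ X} (here refl) ∘ trans (same x))))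
... | tri≈ _ refl _ = cong (x ∷_) (decreasing-ext (Linked.tail dX) (Linked.tail dY) same-tail)
  where
  same-tail : ∀ v → count v X ≡ count v Y
  same-tail v with toSum (v ≟ x)
  ... | inj₁ refl = trans (∉⇒count≡0 (All<⇒∉ (decreasing-head dX))) (sym (∉⇒count≡0 (All<⇒∉ (decreasing-head dY))))
  ... | inj₂ v≢x = trans (sym (count-reject X v≢x)) (trans (same v) (count-reject Y v≢x))

-- B ≼ A is the row condition of the two-column tableau A B, read through counting.
_≼_ : List ℕ → List ℕ → Set
B ≼ A = ∀ c → countBelow c B ≤ countBelow c A

rowsOK⇒≼ : ∀ {xs ys} → RowsOK xs ys → ys ≼ xs
rowsOK⇒≼ rows-[] c = z≤n
rowsOK⇒≼ (rows-∷ {x} {y} {xs} {ys} x≤y r) c with <-≤-connex y c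
... | inj₁ y<c = subst₂ _≤_ (sym (countBelow-accept ys y<c)) (sym (countBelow-accept xs (≤-<-trans x≤y y<c)))
                   (s≤s (rowsOK⇒≼ r c))
... | inj₂ c≤y = subst (_≤ countBelow c (x ∷ xs)) (sym (countBelow-reject ys (≤⇒≯ c≤y)))
                   (≤-trans (rowsOK⇒≼ r c) (countBelow-cons-≤ c x xs))

youngTableau⇒≼ : ∀ {A B} → YoungTableau A B → B ≼ A
youngTableau⇒≼ {A} {B} t c = subst₂ _≤_ (countBelow-↭ c (↭-reverse B)) (countBelow-↭ c (↭-reverse A)) (rowsOK⇒≼ t c)

lds-suc-++-∈ : ∀ {v} C D → Decreasing C → v ∈ C → lds (suc v) (C ++ D) ≡ suc (lds v (C ++ D))
lds-suc-++-∈ (x ∷ C) D d (here refl) = begin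
    lds (suc x) (x ∷ C ++ D)                    ≡⟨ lds-accept (C ++ D) ≤-refl ⟩
    suc (lds x (C ++ D)) ⊔ lds (suc x) (C ++ D) ≡⟨ m≥n⇒m⊔n≡m (lds-suc-≤ x (C ++ D)) ⟩
    suc (lds x (C ++ D))                        ≡⟨ cong suc (lds-reject (C ++ D) (n≮n x)) ⟨
    suc (lds x (x ∷ C ++ D)) ∎
  where open ≡-Reasoning
lds-suc-++-∈ {v} (x ∷ C) D d (there v∈C) = begin
    lds (suc v) (x ∷ C ++ D) ≡⟨ lds-reject (C ++ D) (<⇒≱ v<x ∘ ≤-pred) ⟩
    lds (suc v) (C ++ D)     ≡⟨ lds-suc-++-∈ C D (Linked.tail d) v∈C ⟩
    suc (lds v (C ++ D))     ≡⟨ cong suc (lds-reject (C ++ D) (<-asym v<x)) ⟨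
    suc (lds v (x ∷ C ++ D)) ∎
  where
  open ≡-Reasoning
  v<x = All.lookup (decreasing-head d) v∈C

lds-suc-++-∉ : ∀ {v} C D k → v ∉ C → lds (suc v) D ≡ lds v D ⊔ k → lds (suc v) (C ++ D) ≡ lds v (C ++ D) ⊔ k
lds-suc-++-∉ [] D k _ eq = eq
lds-suc-++-∉ {v} (x ∷ C) D k v∉ eq with <-cmp x v
... | tri≈ _ refl _ = contradiction (here refl) v∉
... | tri< x<v _ _ = begin
    lds (suc v) (x ∷ C ++ D)                              ≡⟨ lds-accept (C ++ D) (m<n⇒m<1+n x<v) ⟩
    suc (lds x (C ++ D)) ⊔ lds (suc v) (C ++ D)           ≡⟨ cong (suc (lds x (C ++ D)) ⊔_) (lds-suc-++-∉ C D k (v∉ ∘ there) eq) ⟩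
    suc (lds x (C ++ D)) ⊔ (lds v (C ++ D) ⊔ k)           ≡⟨ ⊔-assoc (suc (lds x (C ++ D))) (lds v (C ++ D)) k ⟨
    (suc (lds x (C ++ D)) ⊔ lds v (C ++ D)) ⊔ k           ≡⟨ cong (_⊔ k) (lds-accept (C ++ D) x<v) ⟨
    lds v (x ∷ C ++ D) ⊔ k ∎
  where open ≡-Reasoning
... | tri> _ _ v<x = begin
    lds (suc v) (x ∷ C ++ D) ≡⟨ lds-reject (C ++ D) (<⇒≱ v<x ∘ ≤-pred) ⟩
    lds (suc v) (C ++ D)     ≡⟨ lds-suc-++-∉ C D k (v∉ ∘ there) eq ⟩
    lds v (C ++ D) ⊔ k       ≡⟨ cong (_⊔ k) (lds-reject (C ++ D) (<-asym v<x)) ⟨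
    lds v (x ∷ C ++ D) ⊔ k ∎
  where open ≡-Reasoning

lds-suc-decreasing-∈ : ∀ {v D} → Decreasing D → v ∈ D → lds (suc v) D ≡ lds v D ⊔ suc (countBelow v D)
lds-suc-decreasing-∈ {v} {D} d v∈D = begin
  lds (suc v) D                     ≡⟨ lds-decreasing (suc v) d ⟩
  countBelow (suc v) D              ≡⟨ countBelow-suc-∈ d v∈D ⟩
  suc (countBelow v D)              ≡⟨ m≤n⇒m⊔n≡n (n≤1+n _) ⟨
  countBelow v D ⊔ suc (countBelow v D) ≡⟨ cong (_⊔ suc (countBelow v D)) (lds-decreasing v d) ⟨
  lds v D ⊔ suc (countBelow v D) ∎
  where open ≡-Reasoning

lds-suc-decreasing-∉ : ∀ {v D} → Decreasing D → v ∉ D → lds (suc v) D ≡ lds v D ⊔ 0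
lds-suc-decreasing-∉ {v} {D} d v∉D = begin
  lds (suc v) D        ≡⟨ lds-decreasing (suc v) d ⟩
  countBelow (suc v) D ≡⟨ countBelow-suc-∉ v∉D ⟩
  countBelow v D       ≡⟨ lds-decreasing v d ⟨
  lds v D              ≡⟨ ⊔-identityʳ _ ⟨
  lds v D ⊔ 0 ∎
  where open ≡-Reasoning

lds-tableau : ∀ {A B} → Decreasing A → Decreasing B → B ≼ A → ∀ c → lds c (A ++ B) ≡ countBelow c A
lds-tableau {A} {B} dA dB B≼A zero = trans (lds-zero (A ++ B)) (sym (countBelow-zero A))
lds-tableau {A} {B} dA dB B≼A (suc c) with c ∈? A | c ∈? B
... | yes c∈A | _ = begin
    lds (suc c) (A ++ B) ≡⟨ lds-suc-++-∈ A B dA c∈A ⟩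
    suc (lds c (A ++ B)) ≡⟨ cong suc (lds-tableau dA dB B≼A c) ⟩
    suc (countBelow c A) ≡⟨ countBelow-suc-∈ dA c∈A ⟨
    countBelow (suc c) A ∎
  where open ≡-Reasoning
... | no c∉A | yes c∈B = begin
    lds (suc c) (A ++ B)               ≡⟨ lds-suc-++-∉ A B _ c∉A (lds-suc-decreasing-∈ dB c∈B) ⟩
    lds c (A ++ B) ⊔ suc (countBelow c B) ≡⟨ cong (_⊔ suc (countBelow c B)) (lds-tableau dA dB B≼A c) ⟩
    countBelow c A ⊔ suc (countBelow c B) ≡⟨ m≥n⇒m⊔n≡m B<A ⟩
    countBelow c A                     ≡⟨ countBelow-suc-∉ c∉A ⟨
    countBelow (suc c) A ∎
  where
  open ≡-Reasoning
  B<A : suc (countBelow c B) ≤ countBelow c A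
  B<A = subst₂ _≤_ (countBelow-suc-∈ dB c∈B) (countBelow-suc-∉ c∉A) (B≼A (suc c))
... | no c∉A | no c∉B = begin
    lds (suc c) (A ++ B)   ≡⟨ lds-suc-++-∉ A B 0 c∉A (lds-suc-decreasing-∉ dB c∉B) ⟩
    lds c (A ++ B) ⊔ 0     ≡⟨ ⊔-identityʳ _ ⟩
    lds c (A ++ B)         ≡⟨ lds-tableau dA dB B≼A c ⟩
    countBelow c A         ≡⟨ countBelow-suc-∉ c∉A ⟨
    countBelow (suc c) A ∎
  where open ≡-Reasoning

record IsTransform (A B A' B' : List ℕ) : Set where
  field
    decA    : Decreasing A
    decB    : Decreasing B
    decA'   : Decreasing A'
    decB'   : Decreasing B'
    B≼A     : B ≼ A
    plactic : (A' ++ B') ≡ₚ (A ++ B)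

data Destination (A A' B' : List ℕ) (v : ℕ) : Set where
  stays : count v A' ≡ 1 → count v B' ≡ 0 → Destination A A' B' v
  moves : count v A' ≡ 0 → count v B' ≡ 1 → countBelow v B' ≡ countBelow v A → Destination A A' B' v

module Transform {A B A' B' : List ℕ} (T : IsTransform A B A' B') where
  open IsTransform T

  lds-A'B' : ∀ c → lds c (A' ++ B') ≡ countBelow c A
  lds-A'B' c = trans (lds-plactic plactic c) (lds-tableau decA decB B≼A c)

  content : ∀ v → count v A' + count v B' ≡ count v A + count v B
  content v = trans (sym (count-++ v A' B')) (trans (count-↭ v (plactic⇒↭ plactic)) (count-++ v A B))

  A'⊆A : ∀ {v} → v ∈ A' → v ∈ A
  A'⊆A {v} v∈A' = count≢0⇒∈ λ c≡0 → 1+n≢n (begin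
    suc (countBelow v A)       ≡⟨ cong suc (lds-A'B' v) ⟨
    suc (lds v (A' ++ B'))     ≡⟨ lds-suc-++-∈ A' B' decA' v∈A' ⟨
    lds (suc v) (A' ++ B')     ≡⟨ lds-A'B' (suc v) ⟩
    countBelow (suc v) A       ≡⟨ countBelow-suc v A ⟩
    count v A + countBelow v A ≡⟨ cong (_+ countBelow v A) c≡0 ⟩
    countBelow v A ∎)
    where open ≡-Reasoning

  countBelow-suc-A-B'∖A' : ∀ {v} → v ∉ A' → v ∈ B' → countBelow (suc v) A ≡ countBelow v A ⊔ suc (countBelow v B')
  countBelow-suc-A-B'∖A' {v} v∉A' v∈B' = begin
    countBelow (suc v) A                     ≡⟨ lds-A'B' (suc v) ⟨
    lds (suc v) (A' ++ B')                   ≡⟨ lds-suc-++-∉ A' B' _ v∉A' (lds-suc-decreasing-∈ decB' v∈B') ⟩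
    lds v (A' ++ B') ⊔ suc (countBelow v B') ≡⟨ cong (_⊔ suc (countBelow v B')) (lds-A'B' v) ⟩
    countBelow v A ⊔ suc (countBelow v B') ∎
    where open ≡-Reasoning

  B'∖A'-bound : ∀ {v} → v ∉ A' → v ∈ B' → countBelow v B' < countBelow (suc v) A
  B'∖A'-bound v∉A' v∈B' = subst (_ ≤_) (sym (countBelow-suc-A-B'∖A' v∉A' v∈B')) (m≤n⊔m _ _)

  B'≼A : B' ≼ A
  B'≼A zero = subst₂ _≤_ (sym (countBelow-zero B')) (sym (countBelow-zero A)) z≤n
  B'≼A (suc v) with v ∈? B' | v ∈? A'
  ... | no v∉B' | _ = subst (_≤ countBelow (suc v) A) (sym (countBelow-suc-∉ v∉B'))
                        (≤-trans (B'≼A v) (countBelow-≤-suc v A))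
  ... | yes v∈B' | yes v∈A' = subst₂ _≤_ (sym (countBelow-suc-∈ decB' v∈B')) (sym (countBelow-suc-∈ decA (A'⊆A v∈A')))
                                (s≤s (B'≼A v))
  ... | yes v∈B' | no v∉A' = subst (_≤ countBelow (suc v) A) (sym (countBelow-suc-∈ decB' v∈B')) (B'∖A'-bound v∉A' v∈B')

  stable : ∀ {v} → v ∉ A ⊎ v ∈ B → count v A' ≡ count v A × count v B' ≡ count v B
  stable {v} (inj₁ v∉A) = A'-eq , +-cancelˡ-≡ (count v A) _ _ (trans (cong (_+ count v B') (sym A'-eq)) (content v))
    where A'-eq = trans (∉⇒count≡0 (v∉A ∘ A'⊆A)) (sym (∉⇒count≡0 v∉A))
  stable {v} (inj₂ v∈B) with v ∈? A
  ... | no v∉A = stable (inj₁ v∉A)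
  ... | yes v∈A with bits-+≡2 (count-decreasing-≤1 decA') (count-decreasing-≤1 decB')
                       (trans (content v) (cong₂ _+_ (count-decreasing-∈ decA v∈A) (count-decreasing-∈ decB v∈B)))
  ...   | A'-eq , B'-eq = trans A'-eq (sym (count-decreasing-∈ decA v∈A)) , trans B'-eq (sym (count-decreasing-∈ decB v∈B))

  destination : ∀ {v} → v ∈ A → v ∉ B → Destination A A' B' v
  destination {v} v∈A v∉B with bits-+≡1 (count-decreasing-≤1 decA') (count-decreasing-≤1 decB')
                           (trans (content v) (cong₂ _+_ (count-decreasing-∈ decA v∈A) (∉⇒count≡0 v∉B)))
  ... | inj₁ (A'-eq , B'-eq) = stays A'-eq B'-eq
  ... | inj₂ (A'-eq , B'-eq) = moves A'-eq B'-eq (sym (suc≡⊔suc⇒≡ (trans (sym (countBelow-suc-∈ decA v∈A))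
           (countBelow-suc-A-B'∖A' (count≡0⇒∉ A'-eq) (count≡1⇒∈ B'-eq)))))

  A∩B⊆A'∩B' : ∀ {v} → v ∈ A → v ∈ B → v ∈ A' × v ∈ B'
  A∩B⊆A'∩B' v∈A v∈B with stable (inj₂ v∈B)
  ... | A'-eq , B'-eq = count≡⇒∈ A'-eq v∈A , count≡⇒∈ B'-eq v∈B

record Pivots (A B : List ℕ) (b̃ ã : ℕ) : Set where
  field
    b̃∈B   : b̃ ∈ B
    b̃∉A   : b̃ ∉ A
    ã∈A   : ã ∈ A
    ã∉B   : ã ∉ B
    ã≤b̃   : ã ≤ b̃
    ã-max : ∀ x → x ∈ A → x ∉ B → x ≤ b̃ → x ≤ ã

  ã<b̃ : ã < b̃
  ã<b̃ = ≤∧≢⇒< ã≤b̃ (λ ã≡b̃ → ã∉B (subst (_∈ B) (sym ã≡b̃) b̃∈B))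

  countBelow-between : ∀ {Y c} → Decreasing A → (∀ {w} → w ∈ A → w ∈ B → w ∈ Y) → ã < c → c ≤ b̃ →
                       countBelow b̃ A + countBelow c Y ≤ countBelow c A + countBelow b̃ Y
  countBelow-between {Y} {c} decA A∩B⊆Y ã<c c≤b̃ = countBelow-interval {A} {Y} c≤b̃ A≤Y
    where
    A≤Y : ∀ w → c ≤ w → w < b̃ → count w A ≤ count w Y
    A≤Y w c≤w w<b̃ with w ∈? A | w ∈? B
    ... | no w∉A | _ = subst (_≤ count w Y) (sym (∉⇒count≡0 w∉A)) z≤n
    ... | yes w∈A | yes w∈B = ≤-trans (count-decreasing-≤1 decA) (filter-some (w ≟_) (A∩B⊆Y w∈A w∈B))
    ... | yes w∈A | no w∉B = contradiction (ã-max w w∈A w∉B (<⇒≤ w<b̃)) (<⇒≱ (<-≤-trans ã<c c≤w))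

  -- If ã moved to B', the interval (ã, b̃) would give B' too many letters below b̃
  -- for b̃ to have moved from B to B'.
  ã-stays : ∀ {A' B'} → IsTransform A B A' B' → count ã A' ≡ 1 × count ã B' ≡ 0
  ã-stays {A'} {B'} T with Transform.destination T ã∈A ã∉B
  ... | stays A'₁ B'₀ = A'₁ , B'₀
  ... | moves _ ã-in-B' ã-moved = ⊥-elim (n≮n _ (m+n≤o+p∧p<m⇒n<o between b̃-moved))
    where
    open IsTransform T
    open Transform T
    b̃-moved : countBelow b̃ B' < countBelow b̃ A
    b̃-moved = subst (countBelow b̃ B' <_) (countBelow-suc-∉ b̃∉A)
                (B'∖A'-bound (count≡0⇒∉ (trans (proj₁ (stable (inj₁ b̃∉A))) (∉⇒count≡0 b̃∉A)))
                             (count≡⇒∈ (proj₂ (stable (inj₁ b̃∉A))) b̃∈B))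
    ã-moved′ : countBelow (suc ã) B' ≡ countBelow (suc ã) A
    ã-moved′ = begin
      countBelow (suc ã) B'        ≡⟨ countBelow-suc ã B' ⟩
      count ã B' + countBelow ã B' ≡⟨ cong₂ _+_ ã-in-B' ã-moved ⟩
      suc (countBelow ã A)         ≡⟨ countBelow-suc-∈ decA ã∈A ⟨
      countBelow (suc ã) A ∎
      where open ≡-Reasoning
    between : countBelow b̃ A + countBelow (suc ã) A ≤ countBelow (suc ã) A + countBelow b̃ B'
    between = subst (λ t → countBelow b̃ A + t ≤ countBelow (suc ã) A + countBelow b̃ B') ã-moved′
                (countBelow-between {B'} decA (λ w∈A w∈B → proj₂ (A∩B⊆A'∩B' w∈A w∈B)) ≤-refl ã<b̃)

  ã∈A' : ∀ {A' B'} → IsTransform A B A' B' → ã ∈ A'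
  ã∈A' T = count≡1⇒∈ (proj₁ (ã-stays T))

Exchanged : List ℕ → ℕ → ℕ → List ℕ → Set
Exchanged B b̃ ã B̃ = ∀ x → x ∈ B̃ ⇔ ((x ∈ B × x ≢ b̃) ⊎ x ≡ ã)

module Exchange {A B B̃ : List ℕ} {b̃ ã : ℕ} (P : Pivots A B b̃ ã) (B̃-spec : Exchanged B b̃ ã B̃) where
  open Pivots P

  ã∈B̃ : ã ∈ B̃
  ã∈B̃ = Equivalence.from (B̃-spec ã) (inj₂ refl)

  b̃∉B̃ : b̃ ∉ B̃
  b̃∉B̃ b̃∈B̃ with Equivalence.to (B̃-spec b̃) b̃∈B̃
  ... | inj₁ (_ , b̃≢b̃) = b̃≢b̃ refl
  ... | inj₂ b̃≡ã = <-irrefl (sym b̃≡ã) ã<b̃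

  B̃⇒B : ∀ {v} → v ∈ B̃ → v ≢ ã → v ∈ B
  B̃⇒B {v} v∈B̃ v≢ã with Equivalence.to (B̃-spec v) v∈B̃
  ... | inj₁ (v∈B , _) = v∈B
  ... | inj₂ v≡ã = contradiction v≡ã v≢ã

  B⇒B̃ : ∀ {v} → v ∈ B → v ≢ b̃ → v ∈ B̃
  B⇒B̃ v∈B v≢b̃ = Equivalence.from (B̃-spec _) (inj₁ (v∈B , v≢b̃))

  module _ (decB : Decreasing B) (decB̃ : Decreasing B̃) where

    count-B̃-away : ∀ {v} → v ≢ ã → v ≢ b̃ → count v B̃ ≡ count v B
    count-B̃-away v≢ã v≢b̃ = count-decreasing-⇔ decB̃ decB (λ v∈B̃ → B̃⇒B v∈B̃ v≢ã) (λ v∈B → B⇒B̃ v∈B v≢b̃)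

    count-exchange : ∀ v → count v (b̃ ∷ B̃) ≡ count v (ã ∷ B)
    count-exchange v with toSum (v ≟ ã) | toSum (v ≟ b̃)
    ... | inj₁ refl | _ = begin
        count v (b̃ ∷ B̃) ≡⟨ count-reject B̃ (<⇒≢ ã<b̃) ⟩
        count v B̃       ≡⟨ count-decreasing-∈ decB̃ ã∈B̃ ⟩
        1               ≡⟨ cong suc (∉⇒count≡0 ã∉B) ⟨
        suc (count v B) ≡⟨ count-accept B refl ⟨
        count v (v ∷ B) ∎
      where open ≡-Reasoning
    ... | inj₂ v≢ã | inj₁ refl = begin
        count v (v ∷ B̃) ≡⟨ count-accept B̃ refl ⟩
        suc (count v B̃) ≡⟨ cong suc (∉⇒count≡0 b̃∉B̃) ⟩
        1               ≡⟨ count-decreasing-∈ decB b̃∈B ⟨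
        count v B       ≡⟨ count-reject B v≢ã ⟨
        count v (ã ∷ B) ∎
      where open ≡-Reasoning
    ... | inj₂ v≢ã | inj₂ v≢b̃ = begin
        count v (b̃ ∷ B̃) ≡⟨ count-reject B̃ v≢b̃ ⟩
        count v B̃       ≡⟨ count-B̃-away v≢ã v≢b̃ ⟩
        count v B       ≡⟨ count-reject B v≢ã ⟨
        count v (ã ∷ B) ∎
      where open ≡-Reasoning

    countBelow-exchange : ∀ c → countBelow c (b̃ ∷ B̃) ≡ countBelow c (ã ∷ B)
    countBelow-exchange = countBelow-from-count {b̃ ∷ B̃} {ã ∷ B} count-exchange

    B̃≼A : Decreasing A → B ≼ A → B̃ ≼ A
    B̃≼A decA B≼A c with <-≤-connex b̃ c | <-≤-connex ã c
    ... | inj₁ b̃<c | _ = subst (_≤ countBelow c A) (sym B̃≡B) (B≼A c)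
      where
      B̃≡B : countBelow c B̃ ≡ countBelow c B
      B̃≡B = suc-injective (trans (sym (countBelow-accept B̃ b̃<c))
                            (trans (countBelow-exchange c) (countBelow-accept B (<-trans ã<b̃ b̃<c))))
    ... | inj₂ c≤b̃ | inj₂ c≤ã = subst (_≤ countBelow c A) (sym B̃≡B) (B≼A c)
      where
      B̃≡B : countBelow c B̃ ≡ countBelow c B
      B̃≡B = trans (sym (countBelow-reject B̃ (≤⇒≯ c≤b̃))) (trans (countBelow-exchange c) (countBelow-reject B (≤⇒≯ c≤ã)))
    ... | inj₂ c≤b̃ | inj₁ ã<c = subst (_≤ countBelow c A) (sym B̃≡1+B)
                                  (m+n≤o+p∧p<m⇒n<o (countBelow-between {B} decA (λ _ w∈B → w∈B) ã<c c≤b̃) B<A)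
      where
      B̃≡1+B : countBelow c B̃ ≡ suc (countBelow c B)
      B̃≡1+B = trans (sym (countBelow-reject B̃ (≤⇒≯ c≤b̃))) (trans (countBelow-exchange c) (countBelow-accept B ã<c))
      B<A : countBelow b̃ B < countBelow b̃ A
      B<A = subst₂ _≤_ (countBelow-suc-∈ decB b̃∈B) (countBelow-suc-∉ b̃∉A) (B≼A (suc b̃))

module Replacement {A B B̃ A' B' Ã' B̃' : List ℕ} {b̃ ã : ℕ} (P : Pivots A B b̃ ã) (B̃-spec : Exchanged B b̃ ã B̃)
  (T : IsTransform A B A' B') (T̃ : IsTransform A B̃ Ã' B̃') where
  open Pivots P
  open IsTransform T using (decA; decB; decA')
  open IsTransform T̃ using () renaming (decB to decB̃; decA' to decÃ')
  open Exchange P B̃-spec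
  module T = Transform T
  module T̃ = Transform T̃

  -- If Ã' = A', then b̃ ∷ B̃' and ã ∷ B' have the same content, so P₁ = P₂.  Conversely,
  -- scanning the letters upwards, the first letter at which A' and Ã' differ separates
  -- P₁ from P₂ for good, which is impossible when |B̃'| = |B'|.
  P₁ P₂ : ℕ → ℕ
  P₁ k = countBelow k (b̃ ∷ B̃')
  P₂ k = countBelow k (ã ∷ B')

  AgreeBelow : ℕ → Set
  AgreeBelow k = ∀ v → v < k → count v A' ≡ count v Ã'

  data Comparison (k : ℕ) : Set where
    agree : AgreeBelow k → P₁ k ≡ P₂ k → Comparison k
    above : P₂ k < P₁ k → Comparison k
    below : P₁ k < P₂ k → Comparison k

  data Step (k : ℕ) : Set where
    same : count k (b̃ ∷ B̃') ≡ count k (ã ∷ B') → count k A' ≡ count k Ã' → Step k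
    up   : count k (b̃ ∷ B̃') ≡ 1 → count k (ã ∷ B') ≡ 0 → ¬ P₁ k < P₂ k → Step k
    down : count k (b̃ ∷ B̃') ≡ 0 → count k (ã ∷ B') ≡ 1 → ¬ P₂ k < P₁ k → Step k

  advance : ∀ {k} → Step k → Comparison k → Comparison (suc k)
  advance {k} (same c-eq a-eq) (agree agreeing p-eq) =
    agree extended (trans (countBelow-suc-count (b̃ ∷ B̃') c-eq)
                     (trans (cong (count k (ã ∷ B') +_) p-eq) (sym (countBelow-suc k (ã ∷ B')))))
    where
    extended : AgreeBelow (suc k)
    extended v v<1+k with m<1+n⇒m<n∨m≡n v<1+k
    ... | inj₁ v<k = agreeing v v<k
    ... | inj₂ refl = a-eq
  advance {k} (same c-eq _) (above p<) =
    above (subst₂ _<_ (sym (countBelow-suc k (ã ∷ B'))) (sym (countBelow-suc-count (b̃ ∷ B̃') c-eq)) (+-monoʳ-< _ p<))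
  advance {k} (same c-eq _) (below p<) =
    below (subst₂ _<_ (sym (countBelow-suc-count (b̃ ∷ B̃') c-eq)) (sym (countBelow-suc k (ã ∷ B'))) (+-monoʳ-< _ p<))
  advance {k} (up c₁ c₂ _) (agree _ p-eq) =
    above (subst₂ _<_ (sym (countBelow-suc-count (ã ∷ B') c₂)) (sym (countBelow-suc-count (b̃ ∷ B̃') c₁))
      (subst (_< suc (P₁ k)) p-eq (n<1+n (P₁ k))))
  advance (up c₁ c₂ _) (above p<) =
    above (subst₂ _<_ (sym (countBelow-suc-count (ã ∷ B') c₂)) (sym (countBelow-suc-count (b̃ ∷ B̃') c₁)) (m<n⇒m<1+n p<))
  advance (up _ _ ¬below) (below p<) = contradiction p< ¬below
  advance {k} (down c₁ c₂ _) (agree _ p-eq) =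
    below (subst₂ _<_ (sym (countBelow-suc-count (b̃ ∷ B̃') c₁)) (sym (countBelow-suc-count (ã ∷ B') c₂))
      (subst (_< suc (P₂ k)) (sym p-eq) (n<1+n (P₂ k))))
  advance (down c₁ c₂ _) (below p<) =
    below (subst₂ _<_ (sym (countBelow-suc-count (b̃ ∷ B̃') c₁)) (sym (countBelow-suc-count (ã ∷ B') c₂)) (m<n⇒m<1+n p<))
  advance (down _ _ ¬above) (above p<) = contradiction p< ¬above

  offset : ∀ {k} → k ∈ A → k ∉ B → k ≢ ã →
           Σ[ e ∈ ℕ ] (P₁ k ≡ e + countBelow k B̃' × P₂ k ≡ e + countBelow k B')
  offset {k} k∈A k∉B k≢ã with <-≤-connex b̃ k
  ... | inj₁ b̃<k = 1 , countBelow-accept B̃' b̃<k , countBelow-accept B' (<-trans ã<b̃ b̃<k)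
  ... | inj₂ k≤b̃ = 0 , countBelow-reject B̃' (≤⇒≯ k≤b̃) , countBelow-reject B' (<⇒≯ k<ã)
    where k<ã = ≤∧≢⇒< (ã-max k k∈A k∉B k≤b̃) k≢ã

  offset-cancel : ∀ {k} → k ∈ A → k ∉ B → k ≢ ã →
                  (P₁ k < P₂ k → countBelow k B̃' < countBelow k B') × (P₂ k < P₁ k → countBelow k B' < countBelow k B̃')
  offset-cancel k∈A k∉B k≢ã with offset k∈A k∉B k≢ã
  ... | e , P₁≡ , P₂≡ = +-cancelˡ-< e _ _ ∘ subst₂ _<_ P₁≡ P₂≡ , +-cancelˡ-< e _ _ ∘ subst₂ _<_ P₂≡ P₁≡

  step-ã : Step ã
  step-ã = same (begin
      count ã (b̃ ∷ B̃') ≡⟨ count-reject B̃' (<⇒≢ ã<b̃) ⟩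
      count ã B̃'       ≡⟨ proj₂ (T̃.stable (inj₂ ã∈B̃)) ⟩
      count ã B̃        ≡⟨ count-decreasing-∈ decB̃ ã∈B̃ ⟩
      1                ≡⟨ cong suc (proj₂ (ã-stays T)) ⟨
      suc (count ã B') ≡⟨ count-accept B' refl ⟨
      count ã (ã ∷ B') ∎)
    (begin
      count ã A'       ≡⟨ proj₁ (ã-stays T) ⟩
      1                ≡⟨ count-decreasing-∈ decA ã∈A ⟨
      count ã A        ≡⟨ proj₁ (T̃.stable (inj₂ ã∈B̃)) ⟨
      count ã Ã' ∎)
    where open ≡-Reasoning

  step-b̃ : Step b̃
  step-b̃ = same (begin
      count b̃ (b̃ ∷ B̃') ≡⟨ count-accept B̃' refl ⟩
      suc (count b̃ B̃') ≡⟨ cong suc (proj₂ (T̃.stable (inj₁ b̃∉A))) ⟩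
      suc (count b̃ B̃) ≡⟨ cong suc (∉⇒count≡0 b̃∉B̃) ⟩
      1                ≡⟨ count-decreasing-∈ decB b̃∈B ⟨
      count b̃ B        ≡⟨ proj₂ (T.stable (inj₁ b̃∉A)) ⟨
      count b̃ B'       ≡⟨ count-reject B' (<⇒≢ ã<b̃ ∘ sym) ⟨
      count b̃ (ã ∷ B') ∎)
    (trans (proj₁ (T.stable (inj₁ b̃∉A))) (sym (proj₁ (T̃.stable (inj₁ b̃∉A)))))
    where open ≡-Reasoning

  step-stable : ∀ {k} → k ≢ ã → k ≢ b̃ → k ∉ A ⊎ k ∈ B → Step k
  step-stable {k} k≢ã k≢b̃ k∉A⊎k∈B = same (begin
      count k (b̃ ∷ B̃') ≡⟨ count-reject B̃' k≢b̃ ⟩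
      count k B̃'       ≡⟨ proj₂ (T̃.stable k∉A⊎k∈B̃) ⟩
      count k B̃        ≡⟨ count-B̃-away decB decB̃ k≢ã k≢b̃ ⟩
      count k B        ≡⟨ proj₂ (T.stable k∉A⊎k∈B) ⟨
      count k B'       ≡⟨ count-reject B' k≢ã ⟨
      count k (ã ∷ B') ∎)
    (trans (proj₁ (T.stable k∉A⊎k∈B)) (sym (proj₁ (T̃.stable k∉A⊎k∈B̃))))
    where
    open ≡-Reasoning
    k∉A⊎k∈B̃ : k ∉ A ⊎ k ∈ B̃
    k∉A⊎k∈B̃ = map₂ (λ k∈B → B⇒B̃ k∈B k≢b̃) k∉A⊎k∈B

  step-moving : ∀ {k} → k ≢ ã → k ≢ b̃ → k ∈ A → k ∉ B → Step k
  step-moving {k} k≢ã k≢b̃ k∈A k∉B = compare (T.destination k∈A k∉B) (T̃.destination k∈A (k∉B ∘ flip B̃⇒B k≢ã))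
    where
    B̃'-side : ∀ {c} → count k B̃' ≡ c → count k (b̃ ∷ B̃') ≡ c
    B̃'-side = trans (count-reject B̃' k≢b̃)
    B'-side : ∀ {c} → count k B' ≡ c → count k (ã ∷ B') ≡ c
    B'-side = trans (count-reject B' k≢ã)
    cancel = offset-cancel k∈A k∉B k≢ã
    compare : Destination A A' B' k → Destination A Ã' B̃' k → Step k
    compare (stays A'₁ B'₀) (stays Ã'₁ B̃'₀) = same (trans (B̃'-side B̃'₀) (sym (B'-side B'₀))) (trans A'₁ (sym Ã'₁))
    compare (moves A'₀ B'₁ _) (moves Ã'₀ B̃'₁ _) = same (trans (B̃'-side B̃'₁) (sym (B'-side B'₁))) (trans A'₀ (sym Ã'₀))
    compare (stays _ B'₀) (moves _ B̃'₁ B̃'-full) = up (B̃'-side B̃'₁) (B'-side B'₀) λ p< →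
      <⇒≱ (proj₁ cancel p<)
          (subst (countBelow k B' ≤_) (sym B̃'-full) (T.B'≼A k))
    compare (moves _ B'₁ B'-full) (stays _ B̃'₀) = down (B̃'-side B̃'₀) (B'-side B'₁) λ p< →
      <⇒≱ (proj₂ cancel p<)
          (subst (countBelow k B̃' ≤_) (sym B'-full) (T̃.B'≼A k))

  step : ∀ k → Step k
  step k with toSum (k ≟ ã) | toSum (k ≟ b̃)
  ... | inj₁ refl | _ = step-ã
  ... | inj₂ _ | inj₁ refl = step-b̃
  ... | inj₂ k≢ã | inj₂ k≢b̃ with k ∈? A | k ∈? B
  ...   | no k∉A | _ = step-stable k≢ã k≢b̃ (inj₁ k∉A)
  ...   | yes _ | yes k∈B = step-stable k≢ã k≢b̃ (inj₂ k∈B)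
  ...   | yes k∈A | no k∉B = step-moving k≢ã k≢b̃ k∈A k∉B

  comparison : ∀ k → Comparison k
  comparison zero = agree (λ _ ()) (trans (countBelow-zero (b̃ ∷ B̃')) (sym (countBelow-zero (ã ∷ B'))))
  comparison (suc k) = advance (step k) (comparison k)

  agreeBelow : ∀ k → P₁ k ≡ P₂ k → AgreeBelow k
  agreeBelow k P₁≡P₂ with comparison k
  ... | agree agreeing _ = agreeing
  ... | above p< = contradiction (sym P₁≡P₂) (<⇒≢ p<)
  ... | below p< = contradiction P₁≡P₂ (<⇒≢ p<)

  Ã'≡A' : ∀ {m} → All (_< m) (b̃ ∷ B̃') → All (_< m) (ã ∷ B') → All (_< m) A' → All (_< m) Ã' →
          length B̃' ≡ length B' → Ã' ≡ A'
  Ã'≡A' {m} b̃∷B̃'<m ã∷B'<m A'<m Ã'<m |B̃'|≡|B'| = sym (decreasing-ext decA' decÃ' same-count)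
    where
    P₁≡P₂ : P₁ m ≡ P₂ m
    P₁≡P₂ = trans (countBelow-all b̃∷B̃'<m) (trans (cong suc |B̃'|≡|B'|) (sym (countBelow-all ã∷B'<m)))
    same-count : ∀ v → count v A' ≡ count v Ã'
    same-count v with v <? m
    ... | yes v<m = agreeBelow m P₁≡P₂ v v<m
    ... | no v≮m = trans (∉⇒count≡0 (v≮m ∘ All.lookup A'<m)) (sym (∉⇒count≡0 (v≮m ∘ All.lookup Ã'<m)))

jdt⇒isTransform : ∀ {n A B A' B'} → Column n A → Column n B → B ≼ A → JdT n A B A' B' → IsTransform A B A' B'
jdt⇒isTransform colA colB B≼A (colA' , colB' , _ , _ , plactic) = record
  { decA = proj₁ colA ; decB = proj₁ colB ; decA' = proj₁ colA' ; decB' = proj₁ colB' ; B≼A = B≼A ; plactic = plactic }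

letters<1+n : ∀ {n X} → Column n X → All (_< suc n) X
letters<1+n = All.map (s≤s ∘ proj₂) ∘ proj₂

mainTheorem4 : (n : ℕ) (A B A' B' : List ℕ) →
    Column n A → Column n B → YoungTableau A B →
    JdT n A B A' B' →
    ((b : ℕ) → b ∈ A → b ∈ B → (b ∈ A' × b ∈ B')) ×
    ((b̃ ã : ℕ) →
      b̃ ∈ B → b̃ ∉ A → ((x : ℕ) → x ∈ B → x ∉ A → x ≤ b̃) →
      ã ∈ A → ã ∉ B → ã ≤ b̃ → ((x : ℕ) → x ∈ A → x ∉ B → x ≤ b̃ → x ≤ ã) →
      (ã ∈ A') ×
      ((B̃ Ã' B̃' : List ℕ) → Column n B̃ →
        ((x : ℕ) → x ∈ B̃ ⇔ ((x ∈ B × x ≢ b̃) ⊎ x ≡ ã)) →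
        JdT n A B̃ Ã' B̃' → Ã' ≡ A'))
mainTheorem4 n A B A' B' colA colB tab jdt@(colA' , colB' , _ , |B'|≡|A| , _) =
  (λ _ → Transform.A∩B⊆A'∩B' T) , λ b̃ ã b̃∈B b̃∉A _ ã∈A ã∉B ã≤b̃ ã-max →
    let P = record { b̃∈B = b̃∈B ; b̃∉A = b̃∉A ; ã∈A = ã∈A ; ã∉B = ã∉B ; ã≤b̃ = ã≤b̃ ; ã-max = ã-max }
    in Pivots.ã∈A' P T , λ _ _ _ → replacement P
  where
  B≼A : B ≼ A
  B≼A = youngTableau⇒≼ {A} {B} tab
  T = jdt⇒isTransform colA colB B≼A jdt

  replacement : ∀ {b̃ ã B̃ Ã' B̃'} → Pivots A B b̃ ã → Column n B̃ → Exchanged B b̃ ã B̃ → JdT n A B̃ Ã' B̃' → Ã' ≡ A'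
  replacement {B̃ = B̃} {Ã'} {B̃'} P colB̃ B̃-spec jdt̃@(colÃ' , colB̃' , _ , |B̃'|≡|A| , _) =
    Replacement.Ã'≡A' P B̃-spec T T̃
      (All.lookup (letters<1+n colB) b̃∈B ∷ letters<1+n colB̃') (All.lookup (letters<1+n colA) ã∈A ∷ letters<1+n colB')
      (letters<1+n colA') (letters<1+n colÃ') (trans |B̃'|≡|A| (sym |B'|≡|A|))
    where
    open Pivots P using (b̃∈B; ã∈A)
    T̃ : IsTransform A B̃ Ã' B̃'
    T̃ = jdt⇒isTransform colA colB̃ (Exchange.B̃≼A P B̃-spec (proj₁ colB) (proj₁ colB̃) (proj₁ colA) B≼A) jdt̃
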